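{- For all non-negative integers $m$, $r$ and $k$, there is a bijection between the sets $\overline{\mathcal{F}}(m,r,k)$ and $\overline{\mathcal{M}}(m,r,k)$ (defined in the context).
   Context: Lattice paths use the steps $u=(1,1)$ (up), $d=(1,-1)$ (down) and $f=(1,0)$ (flat). A free Motzkin path of length $n$ is a path consisting of steps $u,d,f$ which starts at $(0,0)$ or at $(0,1)$ and ends at $(n,0)$ (there is no positivity requirement). A Motzkin prefix of length $n$ is a path of $n$ steps $u,d,f$ starting at $(0,0)$ and staying weakly above the $x$-axis, with no restriction on its endpoint. For non-negative integers $m,r,k$: $\mathcal{F}(m,r,k)$ is the set of free Motzkin paths of length $m+r$ with exactly $r$ flat steps that are contained in the strip $-\lfloor k/2\rfloor \le y \le \lfloor (k+1)/2\rfloor$; $\mathcal{M}(m,r,k)$ is the set of Motzkin prefixes of length $m+r$ with exactly $r$ flat steps contained in the strip $0\le y\le k$. Let $L_k$ be the line $y=\lfloor (k+1)/2\rfloor$ if $k$ is odd and the line $y=-\lfloor k/2\rfloor$ if $k$ is even. Then $\overline{\mathcal{F}}(m,r,k)$ is the set of paths in $\mathcal{F}(m,r,k)$ that touch (have a vertex on) the line $L_k$, and $\overline{\mathcal{M}}(m,r,k)$ is the set of paths in $\mathcal{M}(m,r,k)$ that touch the line $y=k$. -}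

module Defs where

open import Data.Bool using (Bool; true; false; T; _∧_; if_then_else_)
open import Data.Nat as ℕ using (ℕ; zero; suc; _/_; _%_)
open import Data.Integer as ℤ using (ℤ; +_; -_; _≤ᵇ_)
open import Data.Integer.Properties using () renaming (_≟_ to _≟ℤ_)
open import Data.List using (List; []; _∷_; length; filterᵇ)
open import Data.Bool.ListAction using (all; any)
open import Data.Product using (Σ; _×_; _,_)
open import Relation.Nullary.Decidable using (⌊_⌋)

-- The three step types: u = (1,1), d = (1,-1), f = (1,0).
data Step : Set where
  u d f : Step

Δ : Step → ℤ
Δ u = + 1
Δ d = - (+ 1)
Δ f = + 0

heights : ℤ → List Step → List ℤ
heights h []       = h ∷ []
heights h (s ∷ ss) = h ∷ heights (h ℤ.+ Δ s) ss

endHeight : ℤ → List Step → ℤ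
endHeight h []       = h
endHeight h (s ∷ ss) = endHeight (h ℤ.+ Δ s) ss

isFlat : Step → Bool
isFlat f = true
isFlat u = false
isFlat d = false

numFlats : List Step → ℕ
numFlats ss = length (filterᵇ isFlat ss)

inStrip : ℤ → ℤ → ℤ → List Step → Bool
inStrip lo hi h ss = all (λ y → (lo ≤ᵇ y) ∧ (y ≤ᵇ hi)) (heights h ss)

touches : ℤ → ℤ → List Step → Bool
touches c h ss = any (λ y → ⌊ y ≟ℤ c ⌋) (heights h ss)

shapeOK : ℕ → ℕ → List Step → Bool
shapeOK m r ss = ⌊ length ss ℕ.≟ m ℕ.+ r ⌋ ∧ ⌊ numFlats ss ℕ.≟ r ⌋

-- Starting height of a free Motzkin path: false ↦ (0,0), true ↦ (0,1).
startHeight : Bool → ℤ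
startHeight false = + 0
startHeight true  = + 1

lowF : ℕ → ℤ
lowF k = - (+ (k / 2))

highF : ℕ → ℤ
highF k = + (suc k / 2)

Lk : ℕ → ℤ
Lk k with k % 2
... | zero  = lowF k
... | suc _ = highF k

isFbar : ℕ → ℕ → ℕ → Bool × List Step → Bool
isFbar m r k (s , ss) =
  shapeOK m r ss
  ∧ ⌊ endHeight (startHeight s) ss ≟ℤ + 0 ⌋
  ∧ inStrip (lowF k) (highF k) (startHeight s) ss
  ∧ touches (Lk k) (startHeight s) ss

Fbar : ℕ → ℕ → ℕ → Set
Fbar m r k = Σ (Bool × List Step) (λ p → T (isFbar m r k p))

isMbar : ℕ → ℕ → ℕ → List Step → Bool
isMbar m r k ss =
  shapeOK m r ss
  ∧ inStrip (+ 0) (+ k) (+ 0) ss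
  ∧ touches (+ k) (+ 0) ss

Mbar : ℕ → ℕ → ℕ → Set
Mbar m r k = Σ (List Step) (λ ss → T (isMbar m r k ss))

-- Both sides are counted by a transfer matrix on the heights 0, …, W of a strip, W = k.
-- Shifting by c = ⌊k/2⌋ turns the free Motzkin paths into the walks between c and c or c + 1,
-- and the Motzkin prefixes are the walks that start at 0. If a kernel K on {0, …, W}² commutes
-- with the adjacency matrix A of the strip, then the walks from s weighted by K i at their end
-- are as many as the walks from i weighted by K (·) s. The kernel K i v = 1 for
-- c ≤ i + v ≤ W + ⌈k/2⌉ and ∣i − v∣ ≤ c + 1 (and 0 otherwise) commutes with A: it has the
-- d'Alembert form F (i + v) + H ∣i − v∣ − 1 and vanishes just outside the strip. As K (·) c ≡ 1
-- and K 0 = δ c + δ (c + 1), prefixes and free paths are equinumerous. The paths touching L_k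
-- are the paths of width k minus those of width k − 1, so they are equinumerous as well.

module Submission where

open import Defs
open import Data.Nat using (ℕ)
open import Function.Bundles using (_⤖_)

open import Data.Bool using (Bool; true; false; T; not; _∧_; _∨_; if_then_else_)
open import Data.Bool.ListAction using (all; any)
open import Data.Bool.Properties using (T-irrelevant; T-≡; T-∧; ∧-assoc; ∧-comm; ∧-identityʳ; ∧-zeroʳ)
open import Data.Fin as Fin using (Fin)
open import Data.Integer as ℤ using (ℤ; +_; -_; -[1+_]; +≤+)
import Data.Integer.Properties as ℤ
open import Data.List
  using (List; []; _∷_; _++_; map; length; lookup; filterᵇ; cartesianProduct; cartesianProductWith)
open import Data.List.Properties using (length-++; filter-++; ++-identityʳ)
open import Data.List.Membership.Propositional using (_∈_)
open import Data.List.Membership.Propositional.Properties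
  using ( ∈-filter⁺; ∈-filter⁻; ∈-lookup
        ; ∈-cartesianProduct⁺; ∈-cartesianProductWith⁺; ∈-cartesianProductWith⁻)
open import Data.List.Membership.Propositional.Properties.WithK using (unique⇒irrelevant)
import Data.List.Relation.Unary.All as All
open import Data.List.Relation.Unary.Any as Any using (here; there)
open import Data.List.Relation.Unary.Any.Properties using (lookup-index)
open import Data.List.Relation.Unary.Unique.Propositional using (Unique; _∷_; [])
import Data.List.Relation.Unary.Unique.Propositional.Properties as Unique
open import Data.Nat
  using (zero; suc; _+_; _*_; _∸_; _≤_; _<_; _≤ᵇ_; _≡ᵇ_; ∣_-_∣; _/_; _%_; z≤n; s≤s; _≟_; _≤?_; _<?_)
open import Data.Nat.DivMod using (m/n≡1+[m∸n]/n; m*n%n≡0; [m+kn]%n≡m%n)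
open import Data.Nat.Properties
open import Data.Nat.Tactic.RingSolver using (solve-∀)
open import Data.Product using (Σ; ∃; _×_; _,_; proj₁; proj₂)
open import Data.Sum using (inj₁; inj₂)
open import Function using (_∘_)
open import Function.Bundles using (_↔_; _⇔_; Equivalence; mk↔ₛ′; mk⇔)
open import Function.Properties.Inverse using (↔-refl; ↔-sym; ↔-trans; ↔⇒⤖)
open import Relation.Binary using (tri<; tri≈; tri>)
open import Relation.Binary.PropositionalEquality
open import Relation.Nullary using (yes; no; contradiction)
open import Relation.Nullary.Decidable using (Dec; ⌊_⌋; T?; does-⇔; isYes≗does; dec-true; toWitness)

open import Algebra.Properties.CommutativeSemigroup +-commutativeSemigroup using (interchange)

𝟙 : Bool → ℕ
𝟙 true  = 1
𝟙 false = 0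

count : ∀ {A : Set} → (A → Bool) → List A → ℕ
count p xs = length (filterᵇ p xs)

count-∷ : ∀ {A : Set} (p : A → Bool) x xs → count p (x ∷ xs) ≡ 𝟙 (p x) + count p xs
count-∷ p x xs with p x
... | true  = refl
... | false = refl

module _ {A : Set} (p : A → Bool) where

  count-++ : ∀ xs ys → count p (xs ++ ys) ≡ count p xs + count p ys
  count-++ xs ys = trans (cong length (filter-++ (T? ∘ p) xs ys)) (length-++ (filterᵇ p xs))

  count-map : ∀ {B : Set} (g : B → A) xs → count p (map g xs) ≡ count (p ∘ g) xs
  count-map g []       = refl
  count-map g (x ∷ xs) = begin
    count p (g x ∷ map g xs)        ≡⟨ count-∷ p (g x) (map g xs) ⟩
    𝟙 (p (g x)) + count p (map g xs) ≡⟨ cong (λ n → 𝟙 (p (g x)) + n) (count-map g xs) ⟩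
    𝟙 (p (g x)) + count (p ∘ g) xs   ≡⟨ count-∷ (p ∘ g) x xs ⟨
    count (p ∘ g) (x ∷ xs)          ∎
    where open ≡-Reasoning

  count-none : ∀ xs → (∀ {x} → x ∈ xs → p x ≡ false) → count p xs ≡ 0
  count-none []       _    = refl
  count-none (x ∷ xs) none = begin
    count p (x ∷ xs)         ≡⟨ count-∷ p x xs ⟩
    𝟙 (p x) + count p xs     ≡⟨ cong₂ _+_ (cong 𝟙 (none (here refl))) (count-none xs (none ∘ there)) ⟩
    0                        ∎
    where open ≡-Reasoning

count-cong : ∀ {A : Set} {p q : A → Bool} xs → (∀ {x} → x ∈ xs → p x ≡ q x) → count p xs ≡ count q xs
count-cong                  []       _  = refl
count-cong {p = p} {q} (x ∷ xs) eq = begin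
  count p (x ∷ xs)     ≡⟨ count-∷ p x xs ⟩
  𝟙 (p x) + count p xs ≡⟨ cong₂ _+_ (cong 𝟙 (eq (here refl))) (count-cong xs (eq ∘ there)) ⟩
  𝟙 (q x) + count q xs ≡⟨ count-∷ q x xs ⟨
  count q (x ∷ xs)     ∎
  where open ≡-Reasoning

count-split : ∀ {A : Set} (p q : A → Bool) xs →
              count (λ x → p x ∧ q x) xs + count (λ x → p x ∧ not (q x)) xs ≡ count p xs
count-split p q []       = refl
count-split p q (x ∷ xs) = begin
  count p∧q (x ∷ xs) + count p∧¬q (x ∷ xs)
    ≡⟨ cong₂ _+_ (count-∷ p∧q x xs) (count-∷ p∧¬q x xs) ⟩
  (𝟙 (p∧q x) + count p∧q xs) + (𝟙 (p∧¬q x) + count p∧¬q xs)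
    ≡⟨ interchange (𝟙 (p∧q x)) (count p∧q xs) (𝟙 (p∧¬q x)) (count p∧¬q xs) ⟩
  (𝟙 (p∧q x) + 𝟙 (p∧¬q x)) + (count p∧q xs + count p∧¬q xs)
    ≡⟨ cong₂ _+_ (𝟙-split (p x) (q x)) (count-split p q xs) ⟩
  𝟙 (p x) + count p xs
    ≡⟨ count-∷ p x xs ⟨
  count p (x ∷ xs) ∎
  where
  open ≡-Reasoning
  p∧q p∧¬q : _ → Bool
  p∧q  y = p y ∧ q y
  p∧¬q y = p y ∧ not (q y)
  𝟙-split : ∀ a b → 𝟙 (a ∧ b) + 𝟙 (a ∧ not b) ≡ 𝟙 a
  𝟙-split true  true  = refl
  𝟙-split true  false = refl
  𝟙-split false _     = refl

index-∈-lookup : ∀ {A : Set} (xs : List A) i → Any.index (∈-lookup {xs = xs} i) ≡ i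
index-∈-lookup (x ∷ xs) Fin.zero    = refl
index-∈-lookup (x ∷ xs) (Fin.suc i) = cong Fin.suc (index-∈-lookup xs i)

members↔Fin : ∀ {A : Set} {xs : List A} → Unique xs → (∃ λ x → x ∈ xs) ↔ Fin (length xs)
members↔Fin {xs = xs} unique =
  mk↔ₛ′ (Any.index ∘ proj₂) (λ i → lookup xs i , ∈-lookup i) (index-∈-lookup xs) lookup-index-∈
  where
  lookup-index-∈ : ∀ (m : ∃ λ x → x ∈ xs) → (lookup xs (Any.index (proj₂ m)) , ∈-lookup _) ≡ m
  lookup-index-∈ (x , x∈xs)
    with lookup xs (Any.index x∈xs) | lookup-index x∈xs | ∈-lookup {xs = xs} (Any.index x∈xs)
  ... | .x | refl | x∈xs′ = cong (x ,_) (unique⇒irrelevant unique x∈xs′ x∈xs)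

module _ {A : Set} (p : A → Bool) {xs : List A} (unique : Unique xs) (complete : ∀ x → T (p x) → x ∈ xs) where

  subset↔Fin-count : Σ A (T ∘ p) ↔ Fin (count p xs)
  subset↔Fin-count =
    ↔-trans (mk↔ₛ′ to from to∘from from∘to) (members↔Fin (Unique.filter⁺ (T? ∘ p) unique))
    where
    to : Σ A (T ∘ p) → ∃ λ x → x ∈ filterᵇ p xs
    to (x , px) = x , ∈-filter⁺ (T? ∘ p) (complete x px) px
    from : (∃ λ x → x ∈ filterᵇ p xs) → Σ A (T ∘ p)
    from (x , x∈) = x , proj₂ (∈-filter⁻ (T? ∘ p) {xs = xs} x∈)
    to∘from : ∀ m → to (from m) ≡ m
    to∘from (x , x∈) = cong (x ,_) (unique⇒irrelevant (Unique.filter⁺ (T? ∘ p) unique) _ _)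
    from∘to : ∀ s → from (to s) ≡ s
    from∘to (x , px) = cong (x ,_) (T-irrelevant _ _)

≤ᵇ-true : ∀ {m n} → m ≤ n → (m ≤ᵇ n) ≡ true
≤ᵇ-true m≤n = Equivalence.to T-≡ (≤⇒≤ᵇ m≤n)

≤ᵇ-false : ∀ {m n} → n < m → (m ≤ᵇ n) ≡ false
≤ᵇ-false {m} {n} n<m with m ≤ᵇ n | ≤ᵇ⇒≤ m n
... | true  | m≤n = contradiction (m≤n _) (<⇒≱ n<m)
... | false | _   = refl

m+∣m-n∣≡n : ∀ {m n} → m ≤ n → m + ∣ m - n ∣ ≡ n
m+∣m-n∣≡n {m} m≤n = trans (cong (λ x → m + x) (m≤n⇒∣m-n∣≡n∸m m≤n)) (m+[n∸m]≡n m≤n)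

private
  sum+distance≤-ordered : ∀ {W i v} → i ≤ v → v ≤ W → i + v + ∣ i - v ∣ ≤ W + W
  sum+distance≤-ordered {W} {i} {v} i≤v v≤W = begin
    i + v + ∣ i - v ∣ ≡⟨ cong (λ x → i + v + x) (m≤n⇒∣m-n∣≡n∸m i≤v) ⟩
    i + v + (v ∸ i)   ≡⟨ cong (_+ (v ∸ i)) (+-comm i v) ⟩
    v + i + (v ∸ i)   ≡⟨ +-assoc v i (v ∸ i) ⟩
    v + (i + (v ∸ i)) ≡⟨ cong (λ x → v + x) (m+[n∸m]≡n i≤v) ⟩
    v + v             ≤⟨ +-mono-≤ v≤W v≤W ⟩
    W + W             ∎
    where open ≤-Reasoning

sum+distance≤ : ∀ {W i v} → i ≤ W → v ≤ W → i + v + ∣ i - v ∣ ≤ W + W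
sum+distance≤ {W} {i} {v} i≤W v≤W with ≤-total i v
... | inj₁ i≤v = sum+distance≤-ordered i≤v v≤W
... | inj₂ v≤i = subst (_≤ W + W) (cong₂ _+_ (+-comm v i) (∣-∣-comm v i)) (sum+distance≤-ordered v≤i i≤W)

δ : ℕ → ℕ → ℕ
δ i v = 𝟙 (∣ i - v ∣ ≡ᵇ 0)

δ-same : ∀ i → δ i i ≡ 1
δ-same i rewrite ∣n-n∣≡0 i = refl

δ-diff : ∀ {i v} → i ≢ v → δ i v ≡ 0
δ-diff {i} {v} i≢v with ∣ i - v ∣ ≡ᵇ 0 | ≡ᵇ⇒≡ ∣ i - v ∣ 0
... | true  | eq = contradiction (∣m-n∣≡0⇒m≡n (eq _)) i≢v
... | false | _  = refl

-- Walks in a strip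

module Strip (W : ℕ) where

  infix 4 _≗ᵂ_
  _≗ᵂ_ : (ℕ → ℕ) → (ℕ → ℕ) → Set
  g ≗ᵂ h = ∀ s → s ≤ W → g s ≡ h s

  down : (ℕ → ℕ) → ℕ → ℕ
  down g zero    = 0
  down g (suc s) = g s

  up : (ℕ → ℕ) → ℕ → ℕ
  up g s = if suc s ≤ᵇ W then g (suc s) else 0

  adj : (ℕ → ℕ) → ℕ → ℕ
  adj g s = down g s + up g s

  -- walks n r w s is the total weight w of the endpoints of the walks of length n with r flat
  -- steps that start at s and stay in [0, W].
  walks : ℕ → ℕ → (ℕ → ℕ) → ℕ → ℕ
  walks zero    zero    w s = w s
  walks zero    (suc r) w s = 0
  walks (suc n) zero    w s = adj (walks n zero w) s
  walks (suc n) (suc r) w s = adj (walks n (suc r) w) s + walks n r w s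

  up-< : ∀ g {s} → s < W → up g s ≡ g (suc s)
  up-< g s<W rewrite ≤ᵇ-true s<W = refl

  up-≥ : ∀ g {s} → W ≤ s → up g s ≡ 0
  up-≥ g W≤s rewrite ≤ᵇ-false (s≤s W≤s) = refl

  adj-cong : ∀ {g h} → g ≗ᵂ h → adj g ≗ᵂ adj h
  adj-cong {g} {h} g≗h s s≤W = cong₂ _+_ (down-cong s s≤W) (up-cong s)
    where
    down-cong : down g ≗ᵂ down h
    down-cong zero    _   = refl
    down-cong (suc s) s<W = g≗h s (<⇒≤ s<W)
    up-cong : ∀ s → up g s ≡ up h s
    up-cong s with s <? W
    ... | yes s<W = trans (up-< g s<W) (trans (g≗h (suc s) s<W) (sym (up-< h s<W)))
    ... | no  s≮W = trans (up-≥ g (≮⇒≥ s≮W)) (sym (up-≥ h (≮⇒≥ s≮W)))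

  down-+ : ∀ g h s → down (λ v → g v + h v) s ≡ down g s + down h s
  down-+ g h zero    = refl
  down-+ g h (suc s) = refl

  up-+ : ∀ g h s → up (λ v → g v + h v) s ≡ up g s + up h s
  up-+ g h s with suc s ≤ᵇ W
  ... | true  = refl
  ... | false = refl

  adj-+ : ∀ g h s → adj (λ v → g v + h v) s ≡ adj g s + adj h s
  adj-+ g h s = trans (cong₂ _+_ (down-+ g h s) (up-+ g h s))
                      (interchange (down g s) (down h s) (up g s) (up h s))

  walks-cong : ∀ n r {w w′} → w ≗ᵂ w′ → walks n r w ≗ᵂ walks n r w′
  walks-cong zero    zero    w≗w′ = w≗w′
  walks-cong zero    (suc r) w≗w′ s _ = refl
  walks-cong (suc n) zero    w≗w′ = adj-cong (walks-cong n zero w≗w′)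
  walks-cong (suc n) (suc r) w≗w′ s s≤W =
    cong₂ _+_ (adj-cong (walks-cong n (suc r) w≗w′) s s≤W) (walks-cong n r w≗w′ s s≤W)

  adj-zero : ∀ s → adj (λ _ → 0) s ≡ 0
  adj-zero s = cong₂ _+_ (down-zero s) (up-zero (suc s ≤ᵇ W))
    where
    down-zero : ∀ s → down (λ _ → 0) s ≡ 0
    down-zero zero    = refl
    down-zero (suc s) = refl
    up-zero : ∀ b → (if b then 0 else 0) ≡ 0
    up-zero true  = refl
    up-zero false = refl

  walks-zero : ∀ n r → walks n r (λ _ → 0) ≗ᵂ (λ _ → 0)
  walks-zero zero    zero    s _   = refl
  walks-zero zero    (suc r) s _   = refl
  walks-zero (suc n) zero    s s≤W = trans (adj-cong (walks-zero n zero) s s≤W) (adj-zero s)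
  walks-zero (suc n) (suc r) s s≤W =
    cong₂ _+_ (trans (adj-cong (walks-zero n (suc r)) s s≤W) (adj-zero s)) (walks-zero n r s s≤W)

  walks-+ : ∀ n r g h → walks n r (λ v → g v + h v) ≗ᵂ (λ s → walks n r g s + walks n r h s)
  walks-+ zero    zero    g h s _   = refl
  walks-+ zero    (suc r) g h s _   = refl
  walks-+ (suc n) zero    g h s s≤W = trans (adj-cong (walks-+ n zero g h) s s≤W) (adj-+ _ _ s)
  walks-+ (suc n) (suc r) g h s s≤W =
    trans (cong₂ _+_ (trans (adj-cong (walks-+ n (suc r) g h) s s≤W) (adj-+ _ _ s)) (walks-+ n r g h s s≤W))
          (interchange (adj (walks n (suc r) g) s) (adj (walks n (suc r) h) s) (walks n r g s) (walks n r h s))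

  walks-distrib-adj : ∀ n r (K : ℕ → ℕ → ℕ) s →
                      walks n r (λ v → adj (λ j → K j v) s) ≗ᵂ (λ t → adj (λ j → walks n r (K j) t) s)
  walks-distrib-adj n r K s t t≤W =
    trans (walks-+ n r (λ v → down (λ j → K j v) s) (λ v → up (λ j → K j v) s) t t≤W)
          (cong₂ _+_ (down-part s) up-part)
    where
    down-part : ∀ s → walks n r (λ v → down (λ j → K j v) s) t ≡ down (λ j → walks n r (K j) t) s
    down-part zero    = walks-zero n r t t≤W
    down-part (suc s) = refl
    up-part : walks n r (λ v → up (λ j → K j v) s) t ≡ up (λ j → walks n r (K j) t) s
    up-part with suc s ≤ᵇ W
    ... | true  = refl
    ... | false = walks-zero n r t t≤W

  walks-adj-comm : ∀ n r w → walks n r (adj w) ≗ᵂ adj (walks n r w)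
  walks-adj-comm zero    zero    w s _   = refl
  walks-adj-comm zero    (suc r) w s _   = sym (adj-zero s)
  walks-adj-comm (suc n) zero    w     = adj-cong (walks-adj-comm n zero w)
  walks-adj-comm (suc n) (suc r) w s s≤W =
    trans (cong₂ _+_ (adj-cong (walks-adj-comm n (suc r) w) s s≤W) (walks-adj-comm n r w s s≤W))
          (sym (adj-+ _ _ s))

  Commutes : (ℕ → ℕ → ℕ) → Set
  Commutes K = ∀ i v → i ≤ W → v ≤ W → adj (K i) v ≡ adj (λ i′ → K i′ v) i

  mutual
    walks-transpose : ∀ {K} → Commutes K → ∀ n r {i s} → i ≤ W → s ≤ W →
                      walks n r (K i) s ≡ walks n r (λ v → K v s) i
    walks-transpose comm zero    zero    _   _   = refl
    walks-transpose comm zero    (suc r) _   _   = refl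
    walks-transpose comm (suc n) zero    i≤W s≤W = adj-walks-transpose comm n zero i≤W s≤W
    walks-transpose comm (suc n) (suc r) i≤W s≤W =
      cong₂ _+_ (adj-walks-transpose comm n (suc r) i≤W s≤W) (walks-transpose comm n r i≤W s≤W)

    adj-walks-transpose : ∀ {K} → Commutes K → ∀ n r {i s} → i ≤ W → s ≤ W →
                          adj (walks n r (K i)) s ≡ adj (walks n r (λ v → K v s)) i
    adj-walks-transpose {K} comm n r {i} {s} i≤W s≤W = begin
      adj (walks n r (K i)) s                 ≡⟨ walks-adj-comm n r (K i) s s≤W ⟨
      walks n r (adj (K i)) s                 ≡⟨ walks-cong n r (λ v v≤W → comm i v i≤W v≤W) s s≤W ⟩
      walks n r (λ v → adj (λ j → K j v) i) s ≡⟨ walks-distrib-adj n r K i s s≤W ⟩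
      adj (λ j → walks n r (K j) s) i         ≡⟨ adj-cong (λ j j≤W → walks-transpose comm n r j≤W s≤W) i i≤W ⟩
      adj (walks n r (λ v → K v s)) i         ∎
      where open ≡-Reasoning

  private
    swap-halves : ∀ w x y z → (w + x) + (y + z) ≡ (w + z) + (y + x)
    swap-halves = solve-∀

  wave : (ℕ → ℕ) → (ℕ → ℕ) → ℕ → ℕ → ℕ
  wave F H i v = F (suc i + suc v) + H ∣ i - v ∣ ∸ 1

  -- A kernel F (i + v) + H ∣i − v∣ solves the discrete wave equation (adjacency in v equals
  -- adjacency in i); the ghost conditions make it vanish just outside the strip, where adj truncates.
  module _ (F H : ℕ → ℕ)
           (ghost-below : ∀ x → x ≤ W → F (suc x) + H (suc x) ≡ 1)
           (ghost-above : ∀ x y → x ≤ W → x + y ≡ suc W → F (suc x + suc (suc W)) + H y ≡ 1) where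

    private
      WaveForm : (ℕ → ℕ → ℕ) → Set
      WaveForm K = ∀ i v → i ≤ W → v ≤ W → K i v + 1 ≡ F (suc i + suc v) + H ∣ i - v ∣

      down-wave : ∀ {K} → WaveForm K → ∀ {i v} → i ≤ W → v ≤ W →
                  down (K i) v + 1 ≡ F (suc i + v) + H ∣ suc i - v ∣
      down-wave form {i} {zero}  i≤W _   =
        trans (sym (ghost-below i i≤W)) (cong (λ σ → F σ + H (suc i)) (sym (+-identityʳ (suc i))))
      down-wave form {i} {suc v} i≤W v<W = form i v i≤W (<⇒≤ v<W)

      up-wave : ∀ {K} → WaveForm K → ∀ {i v} → i ≤ W → v ≤ W →
                up (K i) v + 1 ≡ F (suc i + suc (suc v)) + H ∣ i - suc v ∣
      up-wave {K} form {i} {v} i≤W v≤W with v <? W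
      ... | yes v<W = trans (cong (_+ 1) (up-< (K i) v<W)) (form i (suc v) i≤W v<W)
      ... | no  v≮W = trans (cong (_+ 1) (up-≥ (K i) (≮⇒≥ v≮W)))
                            (subst (λ y → 1 ≡ F (suc i + suc (suc y)) + H ∣ i - suc y ∣)
                                   (≤-antisym (≮⇒≥ v≮W) v≤W)
                                   (sym (ghost-above i ∣ i - suc W ∣ i≤W (m+∣m-n∣≡n (m≤n⇒m≤1+n i≤W)))))

      transpose-form : ∀ {K} → WaveForm K → WaveForm (λ i v → K v i)
      transpose-form form i v i≤W v≤W =
        trans (form v i v≤W i≤W) (cong₂ (λ σ y → F σ + H y) (+-comm (suc v) (suc i)) (∣-∣-comm v i))

      form-commutes : ∀ {K} → WaveForm K → Commutes K
      form-commutes {K} form i v i≤W v≤W = +-cancelʳ-≡ 2 _ _ (begin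
        adj (K i) v + 2
          ≡⟨ split (down (K i) v) (up (K i) v) ⟩
        (down (K i) v + 1) + (up (K i) v + 1)
          ≡⟨ cong₂ _+_ (down-wave form i≤W v≤W) (up-wave form i≤W v≤W) ⟩
        (F (suc i + v) + H ∣ suc i - v ∣) + (F (suc i + suc (suc v)) + H ∣ i - suc v ∣)
          ≡⟨ rearrange ⟩
        (F (suc v + i) + H ∣ suc v - i ∣) + (F (suc v + suc (suc i)) + H ∣ v - suc i ∣)
          ≡⟨ cong₂ _+_ (down-wave (transpose-form form) v≤W i≤W) (up-wave (transpose-form form) v≤W i≤W) ⟨
        (down Kᵀv i + 1) + (up Kᵀv i + 1)
          ≡⟨ split (down Kᵀv i) (up Kᵀv i) ⟨
        adj Kᵀv i + 2 ∎)
        where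
        open ≡-Reasoning
        Kᵀv : ℕ → ℕ
        Kᵀv i′ = K i′ v
        split : ∀ x y → x + y + 2 ≡ (x + 1) + (y + 1)
        split = solve-∀
        shift : ∀ i v → i + suc (suc v) ≡ v + suc (suc i)
        shift = solve-∀
        rearrange : (F (suc i + v) + H ∣ suc i - v ∣) + (F (suc i + suc (suc v)) + H ∣ i - suc v ∣)
                  ≡ (F (suc v + i) + H ∣ suc v - i ∣) + (F (suc v + suc (suc i)) + H ∣ v - suc i ∣)
        rearrange
          rewrite +-comm i v | shift i v | ∣-∣-comm (suc i) v | ∣-∣-comm i (suc v) =
          swap-halves (F (suc v + i)) (H ∣ v - suc i ∣) (F (suc v + suc (suc i))) (H ∣ suc v - i ∣)

    wave-commutes : (∀ i v → i ≤ W → v ≤ W → 1 ≤ F (suc i + suc v) + H ∣ i - v ∣) → Commutes (wave F H)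
    wave-commutes positive = form-commutes (λ i v i≤W v≤W → m∸n+n≡m (positive i v i≤W v≤W))

  δ-commutes : Commutes δ
  δ-commutes =
    wave-commutes (λ _ → 1) (λ x → 𝟙 (x ≡ᵇ 0)) (λ _ _ → refl) ghost-above (λ _ _ _ _ → s≤s z≤n)
    where
    ghost-above : ∀ x y → x ≤ W → x + y ≡ suc W → 1 + 𝟙 (y ≡ᵇ 0) ≡ 1
    ghost-above x zero    x≤W x+0≡1+W =
      contradiction (subst (_≤ W) (trans (sym (+-identityʳ x)) x+0≡1+W) x≤W) 1+n≰n
    ghost-above x (suc y) _   _       = refl

-- The rotated-rectangle kernel

module RotatedRectangle (c c′ : ℕ) (c≤c′ : c ≤ c′) (c′≤1+c : c′ ≤ suc c) where

  W : ℕ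
  W = c + c′

  open Strip W

  sum-band : ℕ → ℕ
  sum-band σ = 𝟙 ((suc (suc c) ≤ᵇ σ) ∧ (σ ≤ᵇ suc (suc (W + c′))))

  distance-band : ℕ → ℕ
  distance-band y = 𝟙 (y ≤ᵇ suc c)

  -- K i v = 1 exactly when c ≤ i + v ≤ W + c′ and ∣ i - v ∣ ≤ c + 1.
  K : ℕ → ℕ → ℕ
  K = wave sum-band distance-band

  private
    sum-band-in : ∀ {σ} → suc (suc c) ≤ σ → σ ≤ suc (suc (W + c′)) → sum-band σ ≡ 1
    sum-band-in lo hi rewrite ≤ᵇ-true lo | ≤ᵇ-true hi = refl

    sum-band-below : ∀ {σ} → σ < suc (suc c) → sum-band σ ≡ 0
    sum-band-below σ<lo rewrite ≤ᵇ-false σ<lo = refl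

    sum-band-above : ∀ {σ} → suc (suc (W + c′)) < σ → sum-band σ ≡ 0
    sum-band-above {σ} hi<σ rewrite ≤ᵇ-false hi<σ | ∧-zeroʳ (suc (suc c) ≤ᵇ σ) = refl

    distance-band-in : ∀ {y} → y ≤ suc c → distance-band y ≡ 1
    distance-band-in d≤ rewrite ≤ᵇ-true d≤ = refl

    distance-band-out : ∀ {y} → suc c < y → distance-band y ≡ 0
    distance-band-out <y rewrite ≤ᵇ-false <y = refl

    +-shift : ∀ x y → suc x + suc (suc y) ≡ suc (suc (suc (y + x)))
    +-shift = solve-∀

    K≡ : ∀ i v {a b} → sum-band (suc i + suc v) ≡ a → distance-band ∣ i - v ∣ ≡ b → K i v ≡ a + b ∸ 1
    K≡ i v = cong₂ (λ a b → a + b ∸ 1)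

    δ+δ≡ : ∀ {v a b} → δ c v ≡ a → δ (suc c) v ≡ b → a + b ≡ δ c v + δ (suc c) v
    δ+δ≡ p q = sym (cong₂ _+_ p q)

    ≤W⇒≤W+c′ : ∀ {x} → x ≤ W → x ≤ W + c′
    ≤W⇒≤W+c′ x≤W = ≤-trans x≤W (m≤m+n W c′)

  ghost-below : ∀ x → x ≤ W → sum-band (suc x) + distance-band (suc x) ≡ 1
  ghost-below x x≤W with x ≤? c
  ... | yes x≤c = cong₂ _+_ (sum-band-below (s≤s (s≤s x≤c))) (distance-band-in (s≤s x≤c))
  ... | no  x≰c = cong₂ _+_ (sum-band-in (s≤s (≰⇒> x≰c)) (s≤s (m≤n⇒m≤1+n (≤W⇒≤W+c′ x≤W))))
                            (distance-band-out (s≤s (≰⇒> x≰c)))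

  ghost-above : ∀ x y → x ≤ W → x + y ≡ suc W → sum-band (suc x + suc (suc W)) + distance-band y ≡ 1
  ghost-above x y x≤W x+y≡1+W with x <? c′
  ... | yes x<c′ = cong₂ _+_ (sum-band-in lo hi) (distance-band-out (+-cancelˡ-≤ x _ _ far))
    where
    lo : suc (suc c) ≤ suc x + suc (suc W)
    lo = ≤-trans (s≤s (s≤s (m≤m+n c c′))) (m≤n+m (suc (suc W)) (suc x))
    hi : suc x + suc (suc W) ≤ suc (suc (W + c′))
    hi = begin
      suc x + suc (suc W)     ≡⟨ +-shift x W ⟩
      suc (suc (suc (W + x))) ≡⟨ cong (suc ∘ suc) (+-suc W x) ⟨
      suc (suc (W + suc x))   ≤⟨ s≤s (s≤s (+-monoʳ-≤ W x<c′)) ⟩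
      suc (suc (W + c′))      ∎
      where open ≤-Reasoning
    far : x + suc (suc c) ≤ x + y
    far = begin
      x + suc (suc c) ≡⟨ +-suc x (suc c) ⟩
      suc x + suc c   ≤⟨ +-monoˡ-≤ (suc c) x<c′ ⟩
      c′ + suc c      ≡⟨ trans (+-suc c′ c) (cong suc (+-comm c′ c)) ⟩
      suc W           ≡⟨ x+y≡1+W ⟨
      x + y           ∎
      where open ≤-Reasoning
  ... | no  x≮c′ = cong₂ _+_ (sum-band-above above) (distance-band-in (+-cancelˡ-≤ x _ _ near))
    where
    c′≤x : c′ ≤ x
    c′≤x = ≮⇒≥ x≮c′
    above : suc (suc (W + c′)) < suc x + suc (suc W)
    above = begin-strict
      suc (suc (W + c′))      <⟨ s≤s (s≤s (s≤s (+-monoʳ-≤ W c′≤x))) ⟩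
      suc (suc (suc (W + x))) ≡⟨ +-shift x W ⟨
      suc x + suc (suc W)     ∎
      where open ≤-Reasoning
    near : x + y ≤ x + suc c
    near = begin
      x + y       ≡⟨ x+y≡1+W ⟩
      suc (c + c′) ≤⟨ s≤s (+-monoʳ-≤ c c′≤x) ⟩
      suc (c + x)  ≡⟨ trans (cong suc (+-comm c x)) (sym (+-suc x c)) ⟩
      x + suc c    ∎
      where open ≤-Reasoning

  positive : ∀ i v → i ≤ W → v ≤ W → 1 ≤ sum-band (suc i + suc v) + distance-band ∣ i - v ∣
  positive i v i≤W v≤W with ∣ i - v ∣ ≤? suc c
  ... | yes near rewrite distance-band-in near = m≤n+m 1 _
  ... | no  far  = subst (λ a → 1 ≤ a + distance-band ∣ i - v ∣) (sym (sum-band-in lo hi)) (s≤s z≤n)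
    where
    c≤i+v : c ≤ i + v
    c≤i+v = ≤-trans (≤-trans (n≤1+n c) (<⇒≤ (≰⇒> far))) (≤-trans (∣m-n∣≤m⊔n i v) (m⊔n≤m+n i v))
    lo : suc (suc c) ≤ suc i + suc v
    lo = s≤s (subst (suc c ≤_) (sym (+-suc i v)) (s≤s c≤i+v))
    i+v≤ : i + v ≤ W + c′
    i+v≤ = +-cancelʳ-≤ c _ _ (begin
      i + v + c               ≤⟨ +-monoʳ-≤ (i + v) (≤-trans (n≤1+n c) (<⇒≤ (≰⇒> far))) ⟩
      i + v + ∣ i - v ∣       ≤⟨ sum+distance≤ i≤W v≤W ⟩
      W + W                   ≡⟨ cong (λ x → W + x) (+-comm c c′) ⟩
      W + (c′ + c)            ≡⟨ +-assoc W c′ c ⟨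
      W + c′ + c              ∎)
      where open ≤-Reasoning
    hi : suc i + suc v ≤ suc (suc (W + c′))
    hi = s≤s (subst (_≤ suc (W + c′)) (sym (+-suc i v)) (s≤s i+v≤))

  K-commutes : Commutes K
  K-commutes = wave-commutes sum-band distance-band ghost-below ghost-above positive

  K-column : ∀ i → i ≤ W → K i c ≡ 1
  K-column i i≤W = K≡ i c (sum-band-in lo hi) (distance-band-in near)
    where
    lo : suc (suc c) ≤ suc i + suc c
    lo = s≤s (m≤n+m (suc c) i)
    hi : suc i + suc c ≤ suc (suc (W + c′))
    hi = s≤s (subst (_≤ suc (W + c′)) (sym (+-suc i c)) (s≤s (+-mono-≤ i≤W c≤c′)))
    near : ∣ i - c ∣ ≤ suc c
    near with ≤-total i c
    ... | inj₁ i≤c = begin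
      ∣ i - c ∣ ≡⟨ m≤n⇒∣m-n∣≡n∸m i≤c ⟩
      c ∸ i     ≤⟨ m∸n≤m c i ⟩
      c         ≤⟨ n≤1+n c ⟩
      suc c     ∎
      where open ≤-Reasoning
    ... | inj₂ c≤i = begin
      ∣ i - c ∣ ≡⟨ ∣-∣-comm i c ⟩
      ∣ c - i ∣ ≡⟨ m≤n⇒∣m-n∣≡n∸m c≤i ⟩
      i ∸ c     ≤⟨ ∸-monoˡ-≤ c i≤W ⟩
      W ∸ c     ≡⟨ m+n∸m≡n c c′ ⟩
      c′        ≤⟨ c′≤1+c ⟩
      suc c     ∎
      where open ≤-Reasoning

  K-row₀ : K 0 ≗ᵂ (λ v → δ c v + δ (suc c) v)
  K-row₀ v v≤W with <-cmp v c
  ... | tri< v<c _ _ =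
    trans (K≡ 0 v (sum-band-below (s≤s (s≤s v<c))) (distance-band-in (≤-trans (<⇒≤ v<c) (n≤1+n c))))
          (δ+δ≡ (δ-diff (≢-sym (<⇒≢ v<c))) (δ-diff (≢-sym (<⇒≢ (m<n⇒m<1+n v<c)))))
  ... | tri≈ _ refl _ =
    trans (K≡ 0 v (sum-band-in ≤-refl (s≤s (s≤s (≤W⇒≤W+c′ v≤W)))) (distance-band-in (n≤1+n c)))
          (δ+δ≡ (δ-same c) (δ-diff (1+n≢n {c})))
  ... | tri> _ _ c<v with <-cmp v (suc c)
  ...   | tri< v<1+c _ _ = contradiction (≤-pred v<1+c) (<⇒≱ c<v)
  ...   | tri≈ _ refl _  =
    trans (K≡ 0 v (sum-band-in (n≤1+n _) (s≤s (s≤s (≤W⇒≤W+c′ v≤W)))) (distance-band-in ≤-refl))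
          (δ+δ≡ (δ-diff (<⇒≢ c<v)) (δ-same (suc c)))
  ...   | tri> _ _ 1+c<v =
    trans (K≡ 0 v (sum-band-in (s≤s (s≤s (<⇒≤ c<v))) (s≤s (s≤s (≤W⇒≤W+c′ v≤W))))
                  (distance-band-out 1+c<v))
          (δ+δ≡ (δ-diff (<⇒≢ c<v)) (δ-diff (<⇒≢ 1+c<v)))

  walks-folding : ∀ n r → walks n r (λ _ → 1) 0 ≡ walks n r (δ c) c + walks n r (δ (suc c)) c
  walks-folding n r = begin
    walks n r (λ _ → 1) 0                     ≡⟨ walks-cong n r (λ v v≤W → sym (K-column v v≤W)) 0 z≤n ⟩
    walks n r (λ v → K v c) 0                 ≡⟨ walks-transpose K-commutes n r z≤n c≤W ⟨
    walks n r (K 0) c                         ≡⟨ walks-cong n r K-row₀ c c≤W ⟩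
    walks n r (λ v → δ c v + δ (suc c) v) c   ≡⟨ walks-+ n r (δ c) (δ (suc c)) c c≤W ⟩
    walks n r (δ c) c + walks n r (δ (suc c)) c ∎
    where
    open ≡-Reasoning
    c≤W : c ≤ W
    c≤W = m≤m+n c c′

steps : List Step
steps = u ∷ d ∷ f ∷ []

stepLists : ℕ → List (List Step)
stepLists zero    = [] ∷ []
stepLists (suc n) = cartesianProductWith _∷_ steps (stepLists n)

stepLists-unique : ∀ n → Unique (stepLists n)
stepLists-unique zero    = All.[] ∷ []
stepLists-unique (suc n) = Unique.cartesianProductWith⁺ _∷_ ∷-injective steps-unique (stepLists-unique n)
  where
  ∷-injective : ∀ {s t : Step} {ss ts} → s ∷ ss ≡ t ∷ ts → s ≡ t × ss ≡ ts
  ∷-injective refl = refl , refl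
  steps-unique : Unique steps
  steps-unique = ((λ ()) All.∷ (λ ()) All.∷ All.[]) ∷ ((λ ()) All.∷ All.[]) ∷ All.[] ∷ []

stepLists-complete : ∀ ss → ss ∈ stepLists (length ss)
stepLists-complete []       = here refl
stepLists-complete (s ∷ ss) = ∈-cartesianProductWith⁺ _∷_ (∈-steps s) (stepLists-complete ss)
  where
  ∈-steps : ∀ s → s ∈ steps
  ∈-steps u = here refl
  ∈-steps d = there (here refl)
  ∈-steps f = there (there (here refl))

∈-stepLists⇒length : ∀ {n ss} → ss ∈ stepLists n → length ss ≡ n
∈-stepLists⇒length {zero}  (here refl) = refl
∈-stepLists⇒length {suc n} ss∈ with ∈-cartesianProductWith⁻ _∷_ steps (stepLists n) ss∈
... | _ , _ , _ , ts∈ , refl = cong suc (∈-stepLists⇒length ts∈)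

count-stepLists-suc : ∀ p n → count p (stepLists (suc n)) ≡
  count (p ∘ (u ∷_)) (stepLists n) + (count (p ∘ (d ∷_)) (stepLists n) + count (p ∘ (f ∷_)) (stepLists n))
count-stepLists-suc p n = begin
  count p (map (u ∷_) L ++ (map (d ∷_) L ++ (map (f ∷_) L ++ [])))
    ≡⟨ count-++ p (map (u ∷_) L) _ ⟩
  count p (map (u ∷_) L) + count p (map (d ∷_) L ++ (map (f ∷_) L ++ []))
    ≡⟨ cong (λ z → count p (map (u ∷_) L) + z) (count-++ p (map (d ∷_) L) _) ⟩
  count p (map (u ∷_) L) + (count p (map (d ∷_) L) + count p (map (f ∷_) L ++ []))
    ≡⟨ cong₂ (λ a b → a + (count p (map (d ∷_) L) + b)) (count-map p (u ∷_) L)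
                                                      (cong (count p) (++-identityʳ (map (f ∷_) L))) ⟩
  count (p ∘ (u ∷_)) L + (count p (map (d ∷_) L) + count p (map (f ∷_) L))
    ≡⟨ cong₂ (λ a b → count (p ∘ (u ∷_)) L + (a + b)) (count-map p (d ∷_) L) (count-map p (f ∷_) L) ⟩
  count (p ∘ (u ∷_)) L + (count (p ∘ (d ∷_)) L + count (p ∘ (f ∷_)) L) ∎
  where
  open ≡-Reasoning
  L = stepLists n

-- Paths in a strip as walks

⌊⌋-⇔ : ∀ {A B : Set} → A ⇔ B → (a? : Dec A) (b? : Dec B) → ⌊ a? ⌋ ≡ ⌊ b? ⌋
⌊⌋-⇔ A⇔B a? b? = trans (isYes≗does a?) (trans (does-⇔ A⇔B a? b?) (sym (isYes≗does b?)))

+-cancelˡ-≤ᶻ : ∀ i {j k} → i ℤ.+ j ℤ.≤ i ℤ.+ k → j ℤ.≤ k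
+-cancelˡ-≤ᶻ i {j} {k} le = subst₂ ℤ._≤_ (cancel j) (cancel k) (ℤ.+-monoʳ-≤ (- i) le)
  where
  cancel : ∀ x → - i ℤ.+ (i ℤ.+ x) ≡ x
  cancel x = trans (sym (ℤ.+-assoc (- i) i x)) (trans (cong (ℤ._+ x) (ℤ.+-inverseˡ i)) (ℤ.+-identityˡ x))

≤ᵇ-falseᶻ : ∀ {i j} → j ℤ.< i → (i ℤ.≤ᵇ j) ≡ false
≤ᵇ-falseᶻ {i} {j} j<i with i ℤ.≤ᵇ j | ℤ.≤ᵇ⇒≤ {i} {j}
... | true  | i≤j = contradiction (i≤j _) (ℤ.<⇒≱ j<i)
... | false | _   = refl

shift-up : ∀ lo s → lo ℤ.+ + s ℤ.+ + 1 ≡ lo ℤ.+ + suc s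
shift-up lo s = trans (ℤ.+-assoc lo (+ s) (+ 1)) (cong (λ n → lo ℤ.+ + n) (+-comm s 1))

inRange : ℤ → ℤ → ℤ → Bool
inRange lo hi y = (lo ℤ.≤ᵇ y) ∧ (y ℤ.≤ᵇ hi)

admissible : ℤ → ℤ → (ℤ → Bool) → ℕ → ℤ → List Step → Bool
admissible lo hi E r h ss = ⌊ numFlats ss ≟ r ⌋ ∧ (E (endHeight h ss) ∧ inStrip lo hi h ss)

#admissible : ℤ → ℤ → (ℤ → Bool) → ℕ → ℕ → ℤ → ℕ
#admissible lo hi E n r h = count (admissible lo hi E r h) (stepLists n)

inStrip-outside : ∀ lo hi {h} → inRange lo hi h ≡ false → ∀ ss → inStrip lo hi h ss ≡ false
inStrip-outside lo hi out []      rewrite out = refl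
inStrip-outside lo hi out (_ ∷ _) rewrite out = refl

#admissible-outside : ∀ lo hi E n r {h} → inRange lo hi h ≡ false → #admissible lo hi E n r h ≡ 0
#admissible-outside lo hi E n r {h} out = count-none (admissible lo hi E r h) (stepLists n) (λ {ss} _ → reject ss)
  where
  reject : ∀ ss → admissible lo hi E r h ss ≡ false
  reject ss = begin
    ⌊ numFlats ss ≟ r ⌋ ∧ (E (endHeight h ss) ∧ inStrip lo hi h ss)
      ≡⟨ cong (λ b → ⌊ numFlats ss ≟ r ⌋ ∧ (E (endHeight h ss) ∧ b)) (inStrip-outside lo hi out ss) ⟩
    ⌊ numFlats ss ≟ r ⌋ ∧ (E (endHeight h ss) ∧ false)
      ≡⟨ cong (⌊ numFlats ss ≟ r ⌋ ∧_) (∧-zeroʳ (E (endHeight h ss))) ⟩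
    ⌊ numFlats ss ≟ r ⌋ ∧ false
      ≡⟨ ∧-zeroʳ _ ⟩
    false ∎
    where open ≡-Reasoning

module PathsAsWalks (lo hi : ℤ) (W : ℕ) (width : hi ≡ lo ℤ.+ + W) (E : ℤ → Bool) where

  open Strip W

  #paths : ℕ → ℕ → ℤ → ℕ
  #paths = #admissible lo hi E

  #flat-first : ℕ → ℕ → ℤ → ℕ
  #flat-first n r h = count (admissible lo hi E r h ∘ (f ∷_)) (stepLists n)

  weight : ℕ → ℕ
  weight v = 𝟙 (E (lo ℤ.+ + v))

  inRange-shift : ∀ s → inRange lo hi (lo ℤ.+ + s) ≡ (s ≤ᵇ W)
  inRange-shift s rewrite width | Equivalence.to T-≡ (ℤ.≤⇒≤ᵇ (ℤ.i≤i+j lo (+ s))) =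
    does-⇔ (mk⇔ (λ t → ≤⇒≤ᵇ (ℤ.drop‿+≤+ (+-cancelˡ-≤ᶻ lo (ℤ.≤ᵇ⇒≤ t))))
                (λ t → ℤ.≤⇒≤ᵇ (ℤ.+-monoʳ-≤ lo (+≤+ (≤ᵇ⇒≤ s W t)))))
           (T? _) (T? _)

  inRange-strip : ∀ {s} → s ≤ W → inRange lo hi (lo ℤ.+ + s) ≡ true
  inRange-strip {s} s≤W = trans (inRange-shift s) (≤ᵇ-true s≤W)

  private
    admissible-∷ : ∀ {r h} σ ss → inRange lo hi h ≡ true →
                   admissible lo hi E r h (σ ∷ ss) ≡
                   ⌊ numFlats (σ ∷ ss) ≟ r ⌋ ∧
                   (E (endHeight (h ℤ.+ Δ σ) ss) ∧ inStrip lo hi (h ℤ.+ Δ σ) ss)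
    admissible-∷ σ ss inside rewrite inside = refl

    shift-down : ∀ s → lo ℤ.+ + suc s ℤ.+ - + 1 ≡ lo ℤ.+ + s
    shift-down s = ℤ.+-assoc lo (+ suc s) (- + 1)

    below-bottom : inRange lo hi (lo ℤ.+ + 0 ℤ.+ - + 1) ≡ false
    below-bottom =
      cong (_∧ (lo ℤ.+ + 0 ℤ.+ - + 1 ℤ.≤ᵇ hi))
           (≤ᵇ-falseᶻ (subst (ℤ._< lo) (sym below≡pred) (ℤ.i≤pred[j]⇒i<j ℤ.≤-refl)))
      where
      below≡pred : lo ℤ.+ + 0 ℤ.+ - + 1 ≡ ℤ.pred lo
      below≡pred = trans (cong (ℤ._+ - + 1) (ℤ.+-identityʳ lo)) (ℤ.+-comm lo (- + 1))

  #paths-outside : ∀ n r {h} → inRange lo hi h ≡ false → #paths n r h ≡ 0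
  #paths-outside = #admissible-outside lo hi E

  #paths-suc : ∀ n r {h} → inRange lo hi h ≡ true →
               #paths (suc n) r h ≡ #paths n r (h ℤ.+ - + 1) + #paths n r (h ℤ.+ + 1) + #flat-first n r h
  #paths-suc n r {h} inside = begin
    #paths (suc n) r h
      ≡⟨ count-stepLists-suc (admissible lo hi E r h) n ⟩
    count (admissible lo hi E r h ∘ (u ∷_)) L + (count (admissible lo hi E r h ∘ (d ∷_)) L + #flat-first n r h)
      ≡⟨ cong₂ (λ a b → a + (b + #flat-first n r h)) (count-cong L (λ {ss} _ → admissible-∷ u ss inside))
                                                       (count-cong L (λ {ss} _ → admissible-∷ d ss inside)) ⟩
    #paths n r (h ℤ.+ + 1) + (#paths n r (h ℤ.+ - + 1) + #flat-first n r h)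
      ≡⟨ +-assoc (#paths n r (h ℤ.+ + 1)) _ _ ⟨
    #paths n r (h ℤ.+ + 1) + #paths n r (h ℤ.+ - + 1) + #flat-first n r h
      ≡⟨ cong (_+ #flat-first n r h) (+-comm (#paths n r (h ℤ.+ + 1)) _) ⟩
    #paths n r (h ℤ.+ - + 1) + #paths n r (h ℤ.+ + 1) + #flat-first n r h ∎
    where
    open ≡-Reasoning
    L = stepLists n

  #flat-first-zero : ∀ n h → #flat-first n zero h ≡ 0
  #flat-first-zero n h = count-none _ (stepLists n) (λ _ → refl)

  #flat-first-suc : ∀ n r {h} → inRange lo hi h ≡ true → #flat-first n (suc r) h ≡ #paths n r h
  #flat-first-suc n r {h} inside = count-cong (stepLists n) (λ {ss} _ →
    trans (admissible-∷ {suc r} f ss inside)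
          (cong₂ (λ b y → b ∧ (E (endHeight y ss) ∧ inStrip lo hi y ss))
                 (⌊⌋-⇔ (mk⇔ suc-injective (cong suc)) (suc (numFlats ss) ≟ suc r) (numFlats ss ≟ r))
                 (ℤ.+-identityʳ h)))

  mutual
    #paths≡walks : ∀ n r s → s ≤ W → #paths n r (lo ℤ.+ + s) ≡ walks n r weight s
    #paths≡walks zero zero    s s≤W = begin
      count (admissible lo hi E 0 h) ([] ∷ [])
        ≡⟨ count-∷ (admissible lo hi E 0 h) [] [] ⟩
      𝟙 (E h ∧ (inRange lo hi h ∧ true)) + 0
        ≡⟨ cong (λ b → 𝟙 (E h ∧ b) + 0) (trans (∧-identityʳ (inRange lo hi h)) (inRange-strip s≤W)) ⟩
      𝟙 (E h ∧ true) + 0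
        ≡⟨ cong (λ b → 𝟙 b + 0) (∧-identityʳ (E h)) ⟩
      𝟙 (E h) + 0
        ≡⟨ +-identityʳ (𝟙 (E h)) ⟩
      weight s ∎
      where
      open ≡-Reasoning
      h = lo ℤ.+ + s
    #paths≡walks zero    (suc r) s s≤W = refl
    #paths≡walks (suc n) zero    s s≤W = begin
      #paths (suc n) zero (lo ℤ.+ + s)
        ≡⟨ #paths-suc n zero (inRange-strip s≤W) ⟩
      #paths n zero (lo ℤ.+ + s ℤ.+ - + 1) + #paths n zero (lo ℤ.+ + s ℤ.+ + 1) +
      #flat-first n zero (lo ℤ.+ + s)
        ≡⟨ cong₂ _+_ (neighbours n zero s≤W) (#flat-first-zero n (lo ℤ.+ + s)) ⟩
      adj (walks n zero weight) s + 0
        ≡⟨ +-identityʳ _ ⟩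
      walks (suc n) zero weight s ∎
      where open ≡-Reasoning
    #paths≡walks (suc n) (suc r) s s≤W = begin
      #paths (suc n) (suc r) (lo ℤ.+ + s)
        ≡⟨ #paths-suc n (suc r) (inRange-strip s≤W) ⟩
      #paths n (suc r) (lo ℤ.+ + s ℤ.+ - + 1) + #paths n (suc r) (lo ℤ.+ + s ℤ.+ + 1) +
      #flat-first n (suc r) (lo ℤ.+ + s)
        ≡⟨ cong₂ _+_ (neighbours n (suc r) s≤W)
                     (trans (#flat-first-suc n r (inRange-strip s≤W)) (#paths≡walks n r s s≤W)) ⟩
      walks (suc n) (suc r) weight s ∎
      where open ≡-Reasoning

    neighbours : ∀ n r {s} → s ≤ W →
                 #paths n r (lo ℤ.+ + s ℤ.+ - + 1) + #paths n r (lo ℤ.+ + s ℤ.+ + 1) ≡ adj (walks n r weight) s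
    neighbours n r {s} s≤W = cong₂ _+_ (below s s≤W) above
      where
      below : ∀ s → s ≤ W → #paths n r (lo ℤ.+ + s ℤ.+ - + 1) ≡ down (walks n r weight) s
      below zero    _   = #paths-outside n r below-bottom
      below (suc s) s<W rewrite shift-down s = #paths≡walks n r s (<⇒≤ s<W)
      above : #paths n r (lo ℤ.+ + s ℤ.+ + 1) ≡ up (walks n r weight) s
      above rewrite shift-up lo s with s <? W
      ... | yes s<W = trans (#paths≡walks n r (suc s) s<W) (sym (up-< (walks n r weight) s<W))
      ... | no  s≮W = trans (#paths-outside n r (trans (inRange-shift (suc s)) (≤ᵇ-false (s≤s (≮⇒≥ s≮W)))))
                            (sym (up-≥ (walks n r weight) (≮⇒≥ s≮W)))

-- Paths touching a boundary line

all-∧-not-any : ∀ {A : Set} {p q p′ : A → Bool} → (∀ y → p y ∧ not (q y) ≡ p′ y) →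
                ∀ ys → all p ys ∧ not (any q ys) ≡ all p′ ys
all-∧-not-any eq []       = refl
all-∧-not-any {p = p} {q} eq (y ∷ ys) =
  trans (distribute (p y) (all p ys) (q y) (any q ys)) (cong₂ _∧_ (eq y) (all-∧-not-any eq ys))
  where
  distribute : ∀ a b c e → (a ∧ b) ∧ not (c ∨ e) ≡ (a ∧ not c) ∧ (b ∧ not e)
  distribute true  true  true  e = refl
  distribute true  false true  e = refl
  distribute true  true  false e = refl
  distribute true  false false e = refl
  distribute false b     c     e = refl

narrow-top : ∀ hi y → (y ℤ.≤ᵇ ℤ.suc hi) ∧ not ⌊ y ℤ.≟ ℤ.suc hi ⌋ ≡ (y ℤ.≤ᵇ hi)
narrow-top hi y with y ℤ.≟ ℤ.suc hi
... | yes refl = trans (∧-zeroʳ _) (sym (≤ᵇ-falseᶻ {ℤ.suc hi} {hi} (ℤ.suc[i]≤j⇒i<j ℤ.≤-refl)))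
... | no  y≢   = trans (∧-identityʳ _) (does-⇔ (mk⇔ narrow widen) (T? _) (T? _))
  where
  narrow : T (y ℤ.≤ᵇ ℤ.suc hi) → T (y ℤ.≤ᵇ hi)
  narrow t =
    ℤ.≤⇒≤ᵇ {y} {hi} (+-cancelˡ-≤ᶻ (+ 1) (ℤ.i<j⇒suc[i]≤j (ℤ.≤∧≢⇒< (ℤ.≤ᵇ⇒≤ {y} {ℤ.suc hi} t) y≢)))
  widen : T (y ℤ.≤ᵇ hi) → T (y ℤ.≤ᵇ ℤ.suc hi)
  widen t = ℤ.≤⇒≤ᵇ (ℤ.≤-trans (ℤ.≤ᵇ⇒≤ {y} {hi} t) (ℤ.i≤suc[i] hi))

narrow-bottom : ∀ lo y → (lo ℤ.≤ᵇ y) ∧ not ⌊ y ℤ.≟ lo ⌋ ≡ (ℤ.suc lo ℤ.≤ᵇ y)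
narrow-bottom lo y with y ℤ.≟ lo
... | yes refl = trans (∧-zeroʳ _) (sym (≤ᵇ-falseᶻ {ℤ.suc lo} {lo} (ℤ.suc[i]≤j⇒i<j ℤ.≤-refl)))
... | no  y≢   = trans (∧-identityʳ _) (does-⇔ (mk⇔ narrow widen) (T? _) (T? _))
  where
  narrow : T (lo ℤ.≤ᵇ y) → T (ℤ.suc lo ℤ.≤ᵇ y)
  narrow t = ℤ.≤⇒≤ᵇ (ℤ.i<j⇒suc[i]≤j (ℤ.≤∧≢⇒< (ℤ.≤ᵇ⇒≤ {lo} {y} t) (y≢ ∘ sym)))
  widen : T (ℤ.suc lo ℤ.≤ᵇ y) → T (lo ℤ.≤ᵇ y)
  widen t = ℤ.≤⇒≤ᵇ {lo} {y} (ℤ.<⇒≤ (ℤ.suc[i]≤j⇒i<j (ℤ.≤ᵇ⇒≤ {ℤ.suc lo} {y} t)))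

admissible-touching : ℤ → ℤ → (ℤ → Bool) → ℤ → ℕ → ℤ → List Step → Bool
admissible-touching lo hi E L r h ss =
  ⌊ numFlats ss ≟ r ⌋ ∧ (E (endHeight h ss) ∧ (inStrip lo hi h ss ∧ touches L h ss))

#touching : ℤ → ℤ → (ℤ → Bool) → ℤ → ℕ → ℕ → ℤ → ℕ
#touching lo hi E L n r h = count (admissible-touching lo hi E L r h) (stepLists n)

touching-split : ∀ lo hi lo′ hi′ L E n r h →
                 (∀ y → inRange lo hi y ∧ not ⌊ y ℤ.≟ L ⌋ ≡ inRange lo′ hi′ y) →
                 #touching lo hi E L n r h + #admissible lo′ hi′ E n r h ≡ #admissible lo hi E n r h
touching-split lo hi lo′ hi′ L E n r h narrow = begin
  #touching lo hi E L n r h + #admissible lo′ hi′ E n r h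
    ≡⟨ cong₂ _+_ (count-cong (stepLists n) (λ {ss} _ → sym (touching-∧ ss)))
                 (count-cong (stepLists n) (λ {ss} _ → sym (not-touching-∧ ss))) ⟩
  count (λ ss → admissible lo hi E r h ss ∧ touches L h ss) (stepLists n) +
  count (λ ss → admissible lo hi E r h ss ∧ not (touches L h ss)) (stepLists n)
    ≡⟨ count-split (admissible lo hi E r h) (touches L h) (stepLists n) ⟩
  #admissible lo hi E n r h ∎
  where
  open ≡-Reasoning
  reassoc : ∀ a b c e → (a ∧ (b ∧ c)) ∧ e ≡ a ∧ (b ∧ (c ∧ e))
  reassoc a b c e = trans (∧-assoc a (b ∧ c) e) (cong (a ∧_) (∧-assoc b c e))
  touching-∧ : ∀ ss → admissible lo hi E r h ss ∧ touches L h ss ≡ admissible-touching lo hi E L r h ss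
  touching-∧ ss = reassoc ⌊ numFlats ss ≟ r ⌋ (E (endHeight h ss)) (inStrip lo hi h ss) (touches L h ss)
  not-touching-∧ : ∀ ss → admissible lo hi E r h ss ∧ not (touches L h ss) ≡ admissible lo′ hi′ E r h ss
  not-touching-∧ ss =
    trans (reassoc ⌊ numFlats ss ≟ r ⌋ (E (endHeight h ss)) (inStrip lo hi h ss) (not (touches L h ss)))
          (cong (λ b → ⌊ numFlats ss ≟ r ⌋ ∧ (E (endHeight h ss) ∧ b))
                (all-∧-not-any {p = inRange lo hi} {q = λ y → ⌊ y ℤ.≟ L ⌋} narrow (heights h ss)))

touching-top : ∀ lo hi E n r h →
               #touching lo (ℤ.suc hi) E (ℤ.suc hi) n r h + #admissible lo hi E n r h ≡
               #admissible lo (ℤ.suc hi) E n r h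
touching-top lo hi E n r h = touching-split lo (ℤ.suc hi) lo hi (ℤ.suc hi) E n r h λ y →
  trans (∧-assoc (lo ℤ.≤ᵇ y) _ _) (cong ((lo ℤ.≤ᵇ y) ∧_) (narrow-top hi y))

touching-bottom : ∀ {lo lo′} → ℤ.suc lo ≡ lo′ → ∀ hi E n r h →
                  #touching lo hi E lo n r h + #admissible lo′ hi E n r h ≡ #admissible lo hi E n r h
touching-bottom {lo} refl hi E n r h = touching-split lo hi (ℤ.suc lo) hi lo E n r h λ y →
  trans (swap (lo ℤ.≤ᵇ y) (y ℤ.≤ᵇ hi) _) (cong (_∧ (y ℤ.≤ᵇ hi)) (narrow-bottom lo y))
  where
  swap : ∀ a b c → (a ∧ b) ∧ c ≡ (a ∧ c) ∧ b
  swap true  b c = ∧-comm b c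
  swap false b c = refl

isZeroℤ : ℤ → Bool
isZeroℤ y = ⌊ y ℤ.≟ + 0 ⌋

-- For n = m + r, c = ⌊k/2⌋ and c′ = ⌊(k+1)/2⌋: #M̄ k n r is the size of 𝓜̄(m, r, k) and
-- #F̄ c c′ (Lk k) n r that of 𝓕̄(m, r, k); #M and #F drop the touching condition.
#M : ℕ → ℕ → ℕ → ℕ
#M k n r = #admissible (+ 0) (+ k) (λ _ → true) n r (+ 0)

#F : ℕ → ℕ → ℕ → ℕ → ℕ
#F c c′ n r = #admissible (- + c) (+ c′) isZeroℤ n r (+ 0) + #admissible (- + c) (+ c′) isZeroℤ n r (+ 1)

#F̄ : ℕ → ℕ → ℤ → ℕ → ℕ → ℕ
#F̄ c c′ L n r = #touching (- + c) (+ c′) isZeroℤ L n r (+ 0) + #touching (- + c) (+ c′) isZeroℤ L n r (+ 1)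

#M̄ : ℕ → ℕ → ℕ → ℕ
#M̄ k n r = #touching (+ 0) (+ k) (λ _ → true) (+ k) n r (+ 0)

isZeroℤ-shift : ∀ c v → 𝟙 (isZeroℤ (- + c ℤ.+ + v)) ≡ δ c v
isZeroℤ-shift c v = cong 𝟙 (trans (isYes≗does (- + c ℤ.+ + v ℤ.≟ + 0))
                                  (does-⇔ (mk⇔ to from) (- + c ℤ.+ + v ℤ.≟ + 0) (T? (∣ c - v ∣ ≡ᵇ 0))))
  where
  to : - + c ℤ.+ + v ≡ + 0 → T (∣ c - v ∣ ≡ᵇ 0)
  to eq = ≡⇒≡ᵇ _ 0 (m≡n⇒∣m-n∣≡0 (ℤ.+-injective (begin
    + c                      ≡⟨ ℤ.+-identityʳ (+ c) ⟨
    + c ℤ.+ + 0              ≡⟨ cong (λ x → + c ℤ.+ x) eq ⟨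
    + c ℤ.+ (- + c ℤ.+ + v)  ≡⟨ ℤ.+-assoc (+ c) (- + c) (+ v) ⟨
    + c ℤ.+ - + c ℤ.+ + v    ≡⟨ cong (ℤ._+ + v) (ℤ.+-inverseʳ (+ c)) ⟩
    + 0 ℤ.+ + v              ≡⟨ ℤ.+-identityˡ (+ v) ⟩
    + v                      ∎)))
    where open ≡-Reasoning
  from : T (∣ c - v ∣ ≡ᵇ 0) → - + c ℤ.+ + v ≡ + 0
  from t rewrite ∣m-n∣≡0⇒m≡n {c} {v} (≡ᵇ⇒≡ _ 0 t) = ℤ.+-inverseˡ (+ v)

#F≡#M : ∀ {c c′} → c ≤ c′ → c′ ≤ suc c → ∀ n r → #F c c′ n r ≡ #M (c + c′) n r
#F≡#M {c} {c′} c≤c′ c′≤1+c n r = begin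
  #F c c′ n r
    ≡⟨ cong₂ _+_ (cong (#admissible lo hi isZeroℤ n r) (sym (ℤ.+-inverseˡ (+ c))))
                 (cong (#admissible lo hi isZeroℤ n r) (sym lo+1+c≡1)) ⟩
  F.#paths n r (lo ℤ.+ + c) + F.#paths n r (lo ℤ.+ + suc c)
    ≡⟨ cong₂ _+_ (trans (F.#paths≡walks n r c c≤W) (walks-cong n r weight≗δ c c≤W)) start-above ⟩
  walks n r (δ c) c + walks n r (δ (suc c)) c
    ≡⟨ walks-folding n r ⟨
  walks n r (λ _ → 1) 0
    ≡⟨ M.#paths≡walks n r 0 z≤n ⟨
  #M W n r ∎
  where
  open ≡-Reasoning
  open RotatedRectangle c c′ c≤c′ c′≤1+c
  open Strip W
  lo = - + c
  hi = + c′
  width : hi ≡ lo ℤ.+ + W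
  width = sym (begin
    lo ℤ.+ + (c + c′)        ≡⟨ cong (λ x → lo ℤ.+ x) (ℤ.pos-+ c c′) ⟩
    lo ℤ.+ (+ c ℤ.+ + c′)    ≡⟨ ℤ.+-assoc lo (+ c) (+ c′) ⟨
    lo ℤ.+ + c ℤ.+ + c′      ≡⟨ cong (ℤ._+ + c′) (ℤ.+-inverseˡ (+ c)) ⟩
    + 0 ℤ.+ + c′             ≡⟨ ℤ.+-identityˡ (+ c′) ⟩
    + c′                     ∎)
  module F = PathsAsWalks lo hi W width isZeroℤ
  module M = PathsAsWalks (+ 0) (+ W) W refl (λ _ → true)
  c≤W : c ≤ W
  c≤W = m≤m+n c c′
  lo+1+c≡1 : lo ℤ.+ + suc c ≡ + 1
  lo+1+c≡1 = trans (sym (shift-up lo c)) (cong (ℤ._+ + 1) (ℤ.+-inverseˡ (+ c)))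
  weight≗δ : F.weight ≗ᵂ δ c
  weight≗δ v _ = isZeroℤ-shift c v
  -- suc c exceeds W only for W = 0, when height 1 lies outside the strip.
  start-above : F.#paths n r (lo ℤ.+ + suc c) ≡ walks n r (δ (suc c)) c
  start-above with suc c ≤? W
  ... | yes 1+c≤W = begin
    F.#paths n r (lo ℤ.+ + suc c)      ≡⟨ F.#paths≡walks n r (suc c) 1+c≤W ⟩
    walks n r F.weight (suc c)         ≡⟨ walks-cong n r weight≗δ (suc c) 1+c≤W ⟩
    walks n r (δ c) (suc c)            ≡⟨ walks-transpose δ-commutes n r c≤W 1+c≤W ⟩
    walks n r (λ v → δ v (suc c)) c    ≡⟨ walks-cong n r (λ v _ → cong (λ y → 𝟙 (y ≡ᵇ 0)) (∣-∣-comm v (suc c)))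
                                                     c c≤W ⟩
    walks n r (δ (suc c)) c            ∎
  ... | no  1+c≰W = trans (F.#paths-outside n r (trans (F.inRange-shift (suc c)) (≤ᵇ-false (≰⇒> 1+c≰W))))
                          (sym (trans (walks-cong n r (λ v v≤W → δ-diff (λ 1+c≡v → 1+c≰W (subst (_≤ W) (sym 1+c≡v) v≤W)))
                                                  c c≤W)
                                      (walks-zero n r c c≤W)))

private
  both-starts : ∀ lo hi lo′ hi′ L n r →
                (∀ h → #touching lo hi isZeroℤ L n r h + #admissible lo′ hi′ isZeroℤ n r h ≡
                       #admissible lo hi isZeroℤ n r h) →
                (#touching lo hi isZeroℤ L n r (+ 0) + #touching lo hi isZeroℤ L n r (+ 1)) +
                (#admissible lo′ hi′ isZeroℤ n r (+ 0) + #admissible lo′ hi′ isZeroℤ n r (+ 1)) ≡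
                #admissible lo hi isZeroℤ n r (+ 0) + #admissible lo hi isZeroℤ n r (+ 1)
  both-starts lo hi lo′ hi′ L n r split =
    trans (interchange (#touching lo hi isZeroℤ L n r (+ 0)) (#touching lo hi isZeroℤ L n r (+ 1))
                       (#admissible lo′ hi′ isZeroℤ n r (+ 0)) (#admissible lo′ hi′ isZeroℤ n r (+ 1)))
          (cong₂ _+_ (split (+ 0)) (split (+ 1)))

#F̄≡#M̄-odd : ∀ c n r → #F̄ c (suc c) (+ suc c) n r ≡ #M̄ (suc (c + c)) n r
#F̄≡#M̄-odd c n r = +-cancelʳ-≡ (#M (c + c) n r) _ _ (begin
  #F̄ c (suc c) (+ suc c) n r + #M (c + c) n r
    ≡⟨ cong (λ x → #F̄ c (suc c) (+ suc c) n r + x) (#F≡#M ≤-refl (n≤1+n c) n r) ⟨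
  #F̄ c (suc c) (+ suc c) n r + #F c c n r
    ≡⟨ both-starts (- + c) (+ suc c) (- + c) (+ c) (+ suc c) n r (touching-top (- + c) (+ c) isZeroℤ n r) ⟩
  #F c (suc c) n r
    ≡⟨ #F≡#M (n≤1+n c) ≤-refl n r ⟩
  #M (c + suc c) n r
    ≡⟨ cong (λ k → #M k n r) (+-suc c c) ⟩
  #M (suc (c + c)) n r
    ≡⟨ touching-top (+ 0) (+ (c + c)) (λ _ → true) n r (+ 0) ⟨
  #M̄ (suc (c + c)) n r + #M (c + c) n r ∎)
  where open ≡-Reasoning

private
  suc-neg-suc : ∀ c → ℤ.suc (- + suc c) ≡ - + c
  suc-neg-suc zero    = refl
  suc-neg-suc (suc c) = refl

#F̄≡#M̄-even : ∀ c n r → #F̄ (suc c) (suc c) (- + suc c) n r ≡ #M̄ (suc c + suc c) n r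
#F̄≡#M̄-even c n r = +-cancelʳ-≡ (#M (c + suc c) n r) _ _ (begin
  #F̄ (suc c) (suc c) (- + suc c) n r + #M (c + suc c) n r
    ≡⟨ cong (λ x → #F̄ (suc c) (suc c) (- + suc c) n r + x) (#F≡#M (n≤1+n c) ≤-refl n r) ⟨
  #F̄ (suc c) (suc c) (- + suc c) n r + #F c (suc c) n r
    ≡⟨ both-starts (- + suc c) (+ suc c) (- + c) (+ suc c) (- + suc c) n r
                   (touching-bottom (suc-neg-suc c) (+ suc c) isZeroℤ n r) ⟩
  #F (suc c) (suc c) n r
    ≡⟨ #F≡#M ≤-refl (n≤1+n (suc c)) n r ⟩
  #M (suc c + suc c) n r
    ≡⟨ touching-top (+ 0) (+ (c + suc c)) (λ _ → true) n r (+ 0) ⟨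
  #M̄ (suc c + suc c) n r + #M (c + suc c) n r ∎)
  where open ≡-Reasoning

private
  empty-strip : ∀ E n r h → #admissible (+ 1) (+ 0) E n r h ≡ 0
  empty-strip E n r h = #admissible-outside (+ 1) (+ 0) E n r (outside h)
    where
    outside : ∀ h → inRange (+ 1) (+ 0) h ≡ false
    outside (+ zero)  = refl
    outside (+ suc m) = ∧-zeroʳ (+ 1 ℤ.≤ᵇ + suc m)
    outside -[1+ m ]  = refl

  touching-point : ∀ E n r h → #touching (+ 0) (+ 0) E (+ 0) n r h ≡ #admissible (+ 0) (+ 0) E n r h
  touching-point E n r h = begin
    #touching (+ 0) (+ 0) E (+ 0) n r h                                 ≡⟨ +-identityʳ _ ⟨
    #touching (+ 0) (+ 0) E (+ 0) n r h + 0
      ≡⟨ cong (λ x → #touching (+ 0) (+ 0) E (+ 0) n r h + x) (empty-strip E n r h) ⟨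
    #touching (+ 0) (+ 0) E (+ 0) n r h + #admissible (+ 1) (+ 0) E n r h ≡⟨ touching-bottom refl (+ 0) E n r h ⟩
    #admissible (+ 0) (+ 0) E n r h                                     ∎
    where open ≡-Reasoning

#F̄≡#M̄-zero : ∀ n r → #F̄ 0 0 (+ 0) n r ≡ #M̄ 0 n r
#F̄≡#M̄-zero n r = begin
  #F̄ 0 0 (+ 0) n r ≡⟨ cong₂ _+_ (touching-point isZeroℤ n r (+ 0)) (touching-point isZeroℤ n r (+ 1)) ⟩
  #F 0 0 n r       ≡⟨ #F≡#M z≤n z≤n n r ⟩
  #M 0 n r         ≡⟨ touching-point (λ _ → true) n r (+ 0) ⟨
  #M̄ 0 n r         ∎
  where open ≡-Reasoning

data EvenOdd : ℕ → Set where
  even : ∀ c → EvenOdd (c + c)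
  odd  : ∀ c → EvenOdd (suc (c + c))

evenOdd : ∀ k → EvenOdd k
evenOdd zero    = even 0
evenOdd (suc k) with evenOdd k
... | even c = odd c
... | odd  c = subst EvenOdd (cong suc (+-suc c c)) (even (suc c))

halves : ∀ c → (c + c) / 2 ≡ c × suc (c + c) / 2 ≡ c
halves zero    = refl , refl
halves (suc c) rewrite +-suc c c =
  trans (m/n≡1+[m∸n]/n {suc (suc (c + c))} (s≤s (s≤s z≤n))) (cong suc (proj₁ (halves c))) ,
  trans (m/n≡1+[m∸n]/n {suc (suc (suc (c + c)))} (s≤s (s≤s z≤n))) (cong suc (proj₂ (halves c)))

[c+c]/2≡c : ∀ c → (c + c) / 2 ≡ c
[c+c]/2≡c c = proj₁ (halves c)

[1+c+c]/2≡c : ∀ c → suc (c + c) / 2 ≡ c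
[1+c+c]/2≡c c = proj₂ (halves c)

[2+c+c]/2≡1+c : ∀ c → suc (suc (c + c)) / 2 ≡ suc c
[2+c+c]/2≡1+c c = trans (m/n≡1+[m∸n]/n {suc (suc (c + c))} (s≤s (s≤s z≤n))) (cong suc ([c+c]/2≡c c))

c*2≡c+c : ∀ c → c * 2 ≡ c + c
c*2≡c+c = solve-∀

Lk-even : ∀ c → Lk (c + c) ≡ - + c
Lk-even c = trans (lemma (c + c) (subst (λ k → k % 2 ≡ 0) (c*2≡c+c c) (m*n%n≡0 c 2)))
                  (cong (λ x → - + x) ([c+c]/2≡c c))
  where
  lemma : ∀ k → k % 2 ≡ 0 → Lk k ≡ lowF k
  lemma k eq with k % 2
  lemma k refl | .0 = refl

Lk-odd : ∀ c → Lk (suc (c + c)) ≡ + suc c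
Lk-odd c = trans (lemma (suc (c + c)) (subst (λ k → suc k % 2 ≡ 1) (c*2≡c+c c) ([m+kn]%n≡m%n 1 c 2)))
                 (cong +_ ([2+c+c]/2≡1+c c))
  where
  lemma : ∀ k → k % 2 ≡ 1 → Lk k ≡ highF k
  lemma k eq with k % 2
  lemma k refl | .1 = refl

#F̄≡#M̄ : ∀ k n r → #F̄ (k / 2) (suc k / 2) (Lk k) n r ≡ #M̄ k n r
#F̄≡#M̄ k n r with evenOdd k
... | even zero    = #F̄≡#M̄-zero n r
... | even (suc c) rewrite [c+c]/2≡c (suc c) | [1+c+c]/2≡c (suc c) | Lk-even (suc c) = #F̄≡#M̄-even c n r
... | odd c        rewrite [1+c+c]/2≡c c | [2+c+c]/2≡1+c c | Lk-odd c = #F̄≡#M̄-odd c n r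

freeLists : ℕ → List (Bool × List Step)
freeLists n = cartesianProduct (false ∷ true ∷ []) (stepLists n)

⌊⌋-true : ∀ {A : Set} (a? : Dec A) → A → ⌊ a? ⌋ ≡ true
⌊⌋-true a? a = trans (isYes≗does a?) (dec-true a? a)

shapeOK-stepLists : ∀ m r {ss} → ss ∈ stepLists (m + r) → shapeOK m r ss ≡ ⌊ numFlats ss ≟ r ⌋
shapeOK-stepLists m r {ss} ss∈ =
  cong (_∧ ⌊ numFlats ss ≟ r ⌋) (⌊⌋-true (length ss ≟ m + r) (∈-stepLists⇒length ss∈))

shapeOK⇒length : ∀ m r ss {b} → T (shapeOK m r ss ∧ b) → length ss ≡ m + r
shapeOK⇒length m r ss {b} t =
  toWitness {a? = length ss ≟ m + r}
    (proj₁ (Equivalence.to (T-∧ {⌊ length ss ≟ m + r ⌋})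
                           (proj₁ (Equivalence.to (T-∧ {shapeOK m r ss} {b}) t))))

Fin-cong : ∀ {a b} → a ≡ b → Fin a ↔ Fin b
Fin-cong refl = ↔-refl

Fbar↔Fin : ∀ m r k → Fbar m r k ↔ Fin (#F̄ (k / 2) (suc k / 2) (Lk k) (m + r) r)
Fbar↔Fin m r k = ↔-trans (subset↔Fin-count (isFbar m r k) unique complete) (Fin-cong (begin
  count (isFbar m r k) (map (false ,_) L ++ (map (true ,_) L ++ []))
    ≡⟨ count-++ (isFbar m r k) (map (false ,_) L) _ ⟩
  count (isFbar m r k) (map (false ,_) L) + count (isFbar m r k) (map (true ,_) L ++ [])
    ≡⟨ cong₂ _+_ (count-map (isFbar m r k) (false ,_) L)
                 (trans (cong (count (isFbar m r k)) (++-identityʳ (map (true ,_) L)))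
                        (count-map (isFbar m r k) (true ,_) L)) ⟩
  count (λ ss → isFbar m r k (false , ss)) L + count (λ ss → isFbar m r k (true , ss)) L
    ≡⟨ cong₂ _+_ (count-cong L (λ ss∈ → cong (_∧ _) (shapeOK-stepLists m r ss∈)))
                 (count-cong L (λ ss∈ → cong (_∧ _) (shapeOK-stepLists m r ss∈))) ⟩
  #F̄ (k / 2) (suc k / 2) (Lk k) (m + r) r ∎))
  where
  open ≡-Reasoning
  L = stepLists (m + r)
  unique : Unique (freeLists (m + r))
  unique = Unique.cartesianProduct⁺ (((λ ()) All.∷ All.[]) ∷ All.[] ∷ []) (stepLists-unique (m + r))
  complete : ∀ p → T (isFbar m r k p) → p ∈ freeLists (m + r)
  complete (b , ss) t =
    ∈-cartesianProduct⁺ (bool∈ b) (subst (λ n → ss ∈ stepLists n) (shapeOK⇒length m r ss t) (stepLists-complete ss))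
    where
    bool∈ : ∀ b → b ∈ false ∷ true ∷ []
    bool∈ false = here refl
    bool∈ true  = there (here refl)

Mbar↔Fin : ∀ m r k → Mbar m r k ↔ Fin (#M̄ k (m + r) r)
Mbar↔Fin m r k = ↔-trans (subset↔Fin-count (isMbar m r k) (stepLists-unique (m + r)) complete)
                         (Fin-cong (count-cong (stepLists (m + r))
                                               (λ ss∈ → cong (_∧ _) (shapeOK-stepLists m r ss∈))))
  where
  complete : ∀ ss → T (isMbar m r k ss) → ss ∈ stepLists (m + r)
  complete ss t = subst (λ n → ss ∈ stepLists n) (shapeOK⇒length m r ss t) (stepLists-complete ss)

theorem1p1 : (m r k : ℕ) → Fbar m r k ⤖ Mbar m r k
theorem1p1 m r k = ↔⇒⤖ (↔-trans (Fbar↔Fin m r k)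
                       (↔-trans (Fin-cong (#F̄≡#M̄ k (m + r) r))
                                (↔-sym (Mbar↔Fin m r k))))
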